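{- Let $m\ge2$ and run the job arrival phase of ALG($\alpha_m$) (described in the context) on any job sequence $J_1,\dots,J_n$. Then at every time $t$, $1\le t\le n$, there exists a machine $M_j$ with $\ell_s(j,t)\leq\beta(j)L_t^*$.
   Context: Jobs $J_1,\dots,J_n$ with processing times $p_i>0$ arrive online and are assigned immediately to one of $m$ identical machines $M_1,\dots,M_m$. $H_k=\sum_{i=1}^k1/i$, $H_0=0$; $\alpha_m$ is the unique $\alpha>1$ with $(\alpha-1)(H_{m-1}-H_{\lceil(1-1/\alpha)m\rceil-1}) + \lceil(1-1/\alpha)m\rceil\alpha/m=1$. Notation: $p_t^+=\sum_{i=1}^tp_i$; $p_t^i$ is the $i$-th largest processing time among $J_1,\dots,J_t$ if $i\le t$, else $0$. $L_t=\max\{p_t^+/m,3p_t^{2m+1}\}$. A job $J_i$, $i\le t$, is small at time $t$ if $p_i\le(\alpha_m-1)L_t$, large at time $t$ otherwise. For $i=1,\dots,2m$, $\hat p_t^i=p_t^i$ if $p_t^i>(\alpha_m-1)L_t$, else $0$; $L_t^*=\frac1m(p_t^+-\sum_{i=1}^{2m}\hat p_t^i)$. $\beta(j)=(\alpha_m-1)\frac m{m-j}$ if $j\le\lfloor m/\alpha_m\rfloor$, and $\beta(j)=\alpha_m$ otherwise. $\ell_s(j,t)$ is the load of $M_j$ just before $J_t$ is assigned, counting only jobs that are small at time $t$. Job arrival phase of ALG($\alpha_m$): for each $t$, if $J_t$ is small at time $t$ it is assigned to some machine $M_j$ with $\ell_s(j,t)\le\beta(j)L_t^*$; otherwise it is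 assigned to a machine of least current load.
   Formalization: The processing times $p_i$ of the jobs are rational numbers. -}

module Defs where

open import Data.Nat as ℕ using (ℕ; zero; suc; _∸_)
open import Data.Integer as ℤ using (ℤ; +_)
open import Data.Rational as ℚ using (ℚ; 0ℚ; 1ℚ; _+_; _*_; _-_; _≤_; _<_; _⊔_; _/_; 1/_; ≢-nonZero)
import Data.Rational.Properties as ℚP
open import Data.Fin using (Fin; toℕ)
import Data.Fin as Fin
open import Data.List using (List; []; _∷_; map; applyUpTo; reverse; foldr)
open import Data.List.Sort ℚP.≤-decTotalOrder using (sort)
open import Data.Bool using (Bool; if_then_else_; _∧_)
open import Data.Product using (_×_)
open import Relation.Nullary using (¬_; yes; no; does)

ℕ→ℚ : ℕ → ℚ
ℕ→ℚ k = + k / 1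

-- reciprocal; convention 1/0 := 0 (only ever applied to nonzero values)
inv : ℚ → ℚ
inv p with p ℚP.≟ 0ℚ
... | yes _ = 0ℚ
... | no p≢0 = 1/_ p {{≢-nonZero p≢0}}

H : ℕ → ℚ
H zero = 0ℚ
H (suc k) = H k + (+ 1 / suc k)

-- k(α) = ⌈(1 - 1/α) m⌉  (a positive integer when α > 1)
kα : ℕ → ℚ → ℕ
kα m α = ℤ.∣ ℚ.⌈ (1ℚ - inv α) * ℕ→ℚ m ⌉ ∣

AlphaEq : ℕ → ℚ → Set
AlphaEq m α =
  (α - 1ℚ) * (H (m ∸ 1) - H (kα m α ∸ 1)) + ℕ→ℚ (kα m α) * α * inv (ℕ→ℚ m) ≡ 1ℚ
  where open import Relation.Binary.PropositionalEquality using (_≡_)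

-- β(j) for machine index j ∈ {1..m}
β : ℕ → ℚ → ℕ → ℚ
β m α j =
  if does (+ j ℤ.≤? ℚ.⌊ ℕ→ℚ m * inv α ⌋)
  then (α - 1ℚ) * ℕ→ℚ m * inv (ℕ→ℚ (m ∸ j))
  else α

sumℚ : List ℚ → ℚ
sumℚ = foldr _+_ 0ℚ

range : ℕ → List ℕ
range t = applyUpTo suc t

-- 0-based lookup with default 0
nth : List ℚ → ℕ → ℚ
nth [] _ = 0ℚ
nth (x ∷ _) zero = x
nth (_ ∷ xs) (suc i) = nth xs i

-- Jobs are given by p : ℕ → ℚ, job J_i has processing time p i (i ≥ 1).

pPlus : (ℕ → ℚ) → ℕ → ℚ
pPlus p t = sumℚ (map p (range t))

-- p_t^i : i-th largest (i ≥ 1) among p_1..p_t, 0 if i > t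
pTop : (ℕ → ℚ) → ℕ → ℕ → ℚ
pTop p t i = nth (reverse (sort (map p (range t)))) (i ∸ 1)

L : ℕ → (ℕ → ℚ) → ℕ → ℚ
L m p t = (pPlus p t * inv (ℕ→ℚ m)) ⊔ (ℕ→ℚ 3 * pTop p t (2 ℕ.* m ℕ.+ 1))

isSmall : ℕ → ℚ → (ℕ → ℚ) → ℕ → ℕ → Bool
isSmall m α p t i = does (p i ℚP.≤? (α - 1ℚ) * L m p t)

pHat : ℕ → ℚ → (ℕ → ℚ) → ℕ → ℕ → ℚ
pHat m α p t i =
  if does ((α - 1ℚ) * L m p t ℚP.<? pTop p t i) then pTop p t i else 0ℚ

Lstar : ℕ → ℚ → (ℕ → ℚ) → ℕ → ℚ
Lstar m α p t =
  (pPlus p t - sumℚ (map (pHat m α p t) (range (2 ℕ.* m)))) * inv (ℕ→ℚ m)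

-- machine M_{toℕ j + 1} is represented by j : Fin m; an assignment a : ℕ → Fin m
-- maps job index i to its machine.

smallLoad : (m : ℕ) → ℚ → (ℕ → ℚ) → (ℕ → Fin m) → Fin m → ℕ → ℚ
smallLoad m α p a j t =
  sumℚ (map (λ i → if does (a i Fin.≟ j) ∧ isSmall m α p t i then p i else 0ℚ)
            (range (t ∸ 1)))

load : {m : ℕ} → (ℕ → ℚ) → (ℕ → Fin m) → Fin m → ℕ → ℚ
load p a j t =
  sumℚ (map (λ i → if does (a i Fin.≟ j) then p i else 0ℚ) (range (t ∸ 1)))

-- the assignment of job J_s follows ALG(α)'s job arrival phase
ValidStep : (m : ℕ) → ℚ → (ℕ → ℚ) → (ℕ → Fin m) → ℕ → Set
ValidStep m α p a s =
  (p s ≤ (α - 1ℚ) * L m p s →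
     smallLoad m α p a (a s) s ≤ β m α (suc (toℕ (a s))) * Lstar m α p s)
  × (¬ (p s ≤ (α - 1ℚ) * L m p s) →
     ∀ (k : Fin m) → load p a (a s) s ≤ load p a k s)

module Submission where

-- Averaging over the machines. Summed over j, the loads ℓ_s(j,t) count every job J_i, i < t, that is small
-- at time t exactly once, so their total is at most p_t^+ minus the jobs that are large at time t, and
-- hence at most p_t^+ − Σ_i \hat p_t^i = m L_t^*. On the other side, with q = ⌊m/α⌋ and k = m − q = ⌈(1 − 1/α) m⌉,
-- Σ_j β(j) = (α − 1) m (H_{m−1} − H_{k−1}) + k α, which the defining equation of α makes equal to m.
-- So Σ_j ℓ_s(j,t) ≤ Σ_j β(j) L_t^*, and some machine satisfies the inequality. This holds for every
-- assignment of the earlier jobs.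

open import Defs
open import Data.Nat as ℕ using (ℕ; zero; suc; _∸_; _<_; s≤s; z≤n)
open import Data.Nat using () renaming (_≤_ to _≤ℕ_)
import Data.Nat.Properties as ℕP
import Data.Nat.Coprimality as Coprimality
open import Data.Integer as ℤ using (ℤ)
import Data.Integer.Properties as ℤP
import Data.Integer.DivMod as ℤD
import Data.Integer.Tactic.RingSolver as ℤSolver
open import Data.Rational as ℚ using (ℚ; 0ℚ; 1ℚ; _+_; _*_; _-_; -_; _≤_; ↥_; ↧_; toℚᵘ)
  renaming (_<_ to _<ℚ_)
import Data.Rational.Properties as ℚP
import Data.Rational.Unnormalised as ℚᵘ
import Data.Rational.Unnormalised.Properties as ℚᵘP
open import Data.Rational.Solver using (module +-*-Solver)
open import Algebra.Bundles using (CommutativeRing; CommutativeMonoid)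
open import Algebra.Properties.Semiring.Sum (CommutativeRing.semiring ℚP.+-*-commutativeRing)
open import Algebra.Properties.CommutativeSemigroup (CommutativeMonoid.commutativeSemigroup ℚP.+-0-commutativeMonoid) using (interchange)
open import Data.Fin as Fin using (Fin; toℕ)
import Data.Fin.Properties as FinP
open import Data.Vec.Functional using (init; last)
open import Data.Bool using (if_then_else_; _∧_)
open import Data.Bool.Properties using (if-∧; if-eta)
open import Data.List using ([]; _∷_; map; applyUpTo; reverse; _∷ʳ_)
open import Data.List.Properties using (map-cong; map-∘; map-applyUpTo; applyUpTo-∷ʳ)
open import Data.List.Relation.Unary.All using (All; []; _∷_; universal)
import Data.List.Relation.Unary.All.Properties as All
open import Data.List.Relation.Binary.Permutation.Propositional using (_↭_; ↭-trans; ↭⇒↭ₛ)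
open import Data.List.Relation.Binary.Permutation.Propositional.Properties using (↭-reverse)
import Data.List.Relation.Binary.Permutation.Propositional.Properties as ↭P
import Data.List.Relation.Binary.Permutation.Setoid.Properties as ↭ₛP
open import Data.List.Sort ℚP.≤-decTotalOrder using (sort; sort-↭)
open import Data.Product using (∃-syntax; _,_)
open import Data.Empty using (⊥-elim)
open import Function using (_∘_)
open import Relation.Binary.PropositionalEquality
open import Relation.Nullary using (Dec; yes; no; does)
open import Relation.Nullary.Decidable using (dec-true; dec-false)

fromℤ : ℤ → ℚ
fromℤ z = z ℚ./ 1

toℚᵘ-fromℤ : ∀ z → toℚᵘ (fromℤ z) ℚᵘ.≃ ℚᵘ.mkℚᵘ z 0
toℚᵘ-fromℤ z = ℚP.toℚᵘ-fromℚᵘ (ℚᵘ.mkℚᵘ z 0)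

fromℤ-+ : ∀ i j → fromℤ (i ℤ.+ j) ≡ fromℤ i + fromℤ j
fromℤ-+ i j = ℚP.toℚᵘ-injective (begin
  toℚᵘ (fromℤ (i ℤ.+ j))                ≈⟨ toℚᵘ-fromℤ (i ℤ.+ j) ⟩
  ℚᵘ.mkℚᵘ (i ℤ.+ j) 0                   ≈⟨ ℚᵘ.*≡* (cross i j) ⟩
  ℚᵘ.mkℚᵘ i 0 ℚᵘ.+ ℚᵘ.mkℚᵘ j 0          ≈⟨ ℚᵘP.+-cong (toℚᵘ-fromℤ i) (toℚᵘ-fromℤ j) ⟨
  toℚᵘ (fromℤ i) ℚᵘ.+ toℚᵘ (fromℤ j)    ≈⟨ ℚP.toℚᵘ-homo-+ (fromℤ i) (fromℤ j) ⟨
  toℚᵘ (fromℤ i + fromℤ j)              ∎)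
  where
  open ℚᵘP.≃-Reasoning
  cross : ∀ i j → (i ℤ.+ j) ℤ.* (ℤ.1ℤ ℤ.* ℤ.1ℤ) ≡ (i ℤ.* ℤ.1ℤ ℤ.+ j ℤ.* ℤ.1ℤ) ℤ.* ℤ.1ℤ
  cross = ℤSolver.solve-∀

fromℤ-neg : ∀ i → fromℤ (ℤ.- i) ≡ - fromℤ i
fromℤ-neg i = ℚP.toℚᵘ-injective (begin
  toℚᵘ (fromℤ (ℤ.- i))     ≈⟨ toℚᵘ-fromℤ (ℤ.- i) ⟩
  ℚᵘ.- ℚᵘ.mkℚᵘ i 0         ≈⟨ ℚᵘP.-‿cong (toℚᵘ-fromℤ i) ⟨
  ℚᵘ.- toℚᵘ (fromℤ i)      ≈⟨ ℚP.toℚᵘ-homo‿- (fromℤ i) ⟨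
  toℚᵘ (- fromℤ i)         ∎)
  where open ℚᵘP.≃-Reasoning

fromℤ-- : ∀ i j → fromℤ (i ℤ.- j) ≡ fromℤ i - fromℤ j
fromℤ-- i j = trans (fromℤ-+ i (ℤ.- j)) (cong (_+_ (fromℤ i)) (fromℤ-neg j))

fromℤ-cancel-< : ∀ {i j} → fromℤ i <ℚ fromℤ j → i ℤ.< j
fromℤ-cancel-< {i} {j} i<j
  with ℚᵘP.<-respˡ-≃ (toℚᵘ-fromℤ i) (ℚᵘP.<-respʳ-≃ (toℚᵘ-fromℤ j) (ℚP.toℚᵘ-mono-< i<j))
... | ℚᵘ.*<* i*1<j*1 = ℤP.*-cancelʳ-<-nonNeg ℤ.1ℤ i*1<j*1

fromℤ-<-suc⇒≤ : ∀ {i j} → fromℤ i <ℚ fromℤ (ℤ.suc j) → i ℤ.≤ j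
fromℤ-<-suc⇒≤ {i} {j} i<1+j =
  subst (i ℤ.≤_) (ℤP.pred-suc j) (ℤP.i<j⇒i≤pred[j] {j = ℤ.suc j} (fromℤ-cancel-< i<1+j))

⌊p⌋≤p : ∀ p → fromℤ ℚ.⌊ p ⌋ ≤ p
⌊p⌋≤p p@record{} = ℚP.toℚᵘ-cancel-≤ (ℚᵘP.≤-respˡ-≃ (ℚᵘP.≃-sym (toℚᵘ-fromℤ ℚ.⌊ p ⌋))
  (ℚᵘ.*≤* (subst (ℤ._≤_ _) (sym (ℤP.*-identityʳ (↥ p))) (ℤD.[n/d]*d≤n (↥ p) (↧ p)))))

p<1+⌊p⌋ : ∀ p → p <ℚ fromℤ (ℤ.suc ℚ.⌊ p ⌋)
p<1+⌊p⌋ p@record{} = ℚP.toℚᵘ-cancel-< (ℚᵘP.<-respʳ-≃ (ℚᵘP.≃-sym (toℚᵘ-fromℤ (ℤ.suc ⌊p⌋)))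
  (ℚᵘ.*<* (begin-strict
    ↥ p ℤ.* ℤ.1ℤ                        ≡⟨ ℤP.*-identityʳ (↥ p) ⟩
    ↥ p                                 ≡⟨ ℤD.a≡a%n+[a/n]*n (↥ p) (↧ p) ⟩
    ℤ.+ (↥ p ℤ.% ↧ p) ℤ.+ ⌊p⌋ ℤ.* ↧ p   <⟨ ℤP.+-monoˡ-< (⌊p⌋ ℤ.* ↧ p) (ℤ.+<+ (ℤD.n%d<d (↥ p) (↧ p))) ⟩
    ↧ p ℤ.+ ⌊p⌋ ℤ.* ↧ p                 ≡⟨ cong (ℤ._+ ⌊p⌋ ℤ.* ↧ p) (ℤP.*-identityˡ (↧ p)) ⟨
    ℤ.1ℤ ℤ.* ↧ p ℤ.+ ⌊p⌋ ℤ.* ↧ p        ≡⟨ ℤP.*-distribʳ-+ (↧ p) ℤ.1ℤ ⌊p⌋ ⟨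
    ℤ.suc ⌊p⌋ ℤ.* ↧ p                   ∎)))
  where
  ⌊p⌋ = ℚ.⌊ p ⌋
  open ℤP.≤-Reasoning

⌊⌋-unique : ∀ {p} z → fromℤ z ≤ p → p <ℚ fromℤ (ℤ.suc z) → ℚ.⌊ p ⌋ ≡ z
⌊⌋-unique {p} z z≤p p<1+z = ℤP.≤-antisym
  (fromℤ-<-suc⇒≤ (ℚP.≤-<-trans (⌊p⌋≤p p) p<1+z))
  (fromℤ-<-suc⇒≤ (ℚP.≤-<-trans z≤p (p<1+⌊p⌋ p)))

⌊p-i⌋≡⌊p⌋-i : ∀ p i → ℚ.⌊ p - fromℤ i ⌋ ≡ ℚ.⌊ p ⌋ ℤ.- i
⌊p-i⌋≡⌊p⌋-i p i = ⌊⌋-unique (⌊p⌋ ℤ.- i)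
  (subst (_≤ p - fromℤ i) (sym (fromℤ-- ⌊p⌋ i)) (ℚP.+-monoˡ-≤ (- fromℤ i) (⌊p⌋≤p p)))
  (subst (p - fromℤ i <ℚ_) (trans (sym (fromℤ-- (ℤ.suc ⌊p⌋) i)) (cong fromℤ (ℤP.+-assoc ℤ.1ℤ ⌊p⌋ (ℤ.- i))))
    (ℚP.+-monoˡ-< (- fromℤ i) (p<1+⌊p⌋ p)))
  where ⌊p⌋ = ℚ.⌊ p ⌋

ℕ→ℚ-suc≡mkℚ : ∀ k → ℕ→ℚ (suc k) ≡ ℚ.mkℚ (ℤ.+ suc k) 0 (Coprimality.sym (Coprimality.1-coprimeTo (suc k)))
ℕ→ℚ-suc≡mkℚ k = ℚP.normalize-coprime (Coprimality.sym (Coprimality.1-coprimeTo (suc k)))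

ℕ→ℚ-pos : ∀ k → 0ℚ <ℚ ℕ→ℚ (suc k)
ℕ→ℚ-pos k rewrite ℕ→ℚ-suc≡mkℚ k = ℚP.positive⁻¹ _

ℕ→ℚ-suc : ∀ k → ℕ→ℚ (suc k) ≡ 1ℚ + ℕ→ℚ k
ℕ→ℚ-suc k = fromℤ-+ ℤ.1ℤ (ℤ.+ k)

inv-ℕ→ℚ-suc : ∀ k → inv (ℕ→ℚ (suc k)) ≡ ℤ.1ℤ ℚ./ suc k
inv-ℕ→ℚ-suc k rewrite ℕ→ℚ-suc≡mkℚ k = sym (ℚP.normalize-coprime (Coprimality.1-coprimeTo (suc k)))

inv-inverseʳ : ∀ {p} → p ≢ 0ℚ → p * inv p ≡ 1ℚ
inv-inverseʳ {p} p≢0 with p ℚP.≟ 0ℚ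
... | yes p≡0 = ⊥-elim (p≢0 p≡0)
... | no p≢0 = ℚP.*-inverseʳ p {{ℚ.≢-nonZero p≢0}}

inv-pos : ∀ {p} → 0ℚ <ℚ p → 0ℚ <ℚ inv p
inv-pos {p} 0<p with p ℚP.≟ 0ℚ
... | yes refl = ⊥-elim (ℚP.<-irrefl refl 0<p)
... | no _ = ℚP.positive⁻¹ _ {{ℚP.1/pos⇒pos p {{ℚ.positive 0<p}}}}

inv-<-1 : ∀ {p} → 1ℚ <ℚ p → inv p <ℚ 1ℚ
inv-<-1 {p} 1<p = ℚP.≰⇒> λ 1≤inv → ℚP.<-irrefl refl (ℚP.<-≤-trans 1<p (begin
  p          ≡⟨ ℚP.*-identityʳ p ⟨
  p * 1ℚ     ≤⟨ ℚP.*-monoˡ-≤-nonNeg p {{ℚ.nonNegative (ℚP.<⇒≤ 0<p)}} 1≤inv ⟩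
  p * inv p  ≡⟨ inv-inverseʳ (≢-sym (ℚP.<⇒≢ 0<p)) ⟩
  1ℚ         ∎))
  where
  open ℚP.≤-Reasoning
  0<p : 0ℚ <ℚ p
  0<p = ℚP.<-trans (ℚP.positive⁻¹ 1ℚ) 1<p

*-nonNeg : ∀ {p q} → 0ℚ ≤ p → 0ℚ ≤ q → 0ℚ ≤ p * q
*-nonNeg {p} {q} 0≤p 0≤q =
  ℚP.nonNegative⁻¹ (p * q) {{ℚP.nonNeg*nonNeg⇒nonNeg p {{ℚ.nonNegative 0≤p}} q {{ℚ.nonNegative 0≤q}}}}

H-suc : ∀ k → H (suc k) ≡ H k + inv (ℕ→ℚ (suc k))
H-suc k = cong (H k +_) (sym (inv-ℕ→ℚ-suc k))

sum-toℕ-suc : ∀ n (f : ℕ → ℚ) → ∑[ i < suc n ] f (toℕ i) ≡ ∑[ i < n ] f (toℕ i) + f n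
sum-toℕ-suc n f = begin
  ∑[ i < suc n ] f (toℕ i)                    ≡⟨ sum-init-last {n} (f ∘ toℕ) ⟩
  sum {n} (init (f ∘ toℕ)) + last (f ∘ toℕ)   ≡⟨ cong₂ _+_ (sum-cong-≗ {n} (cong f ∘ FinP.toℕ-inject₁))
                                                           (cong f (FinP.toℕ-fromℕ n)) ⟩
  ∑[ i < n ] f (toℕ i) + f n                  ∎
  where open ≡-Reasoning

sum-toℕ-+ : ∀ n d (f : ℕ → ℚ) →
            ∑[ i < n ℕ.+ d ] f (toℕ i) ≡ ∑[ i < n ] f (toℕ i) + ∑[ i < d ] f (n ℕ.+ toℕ i)
sum-toℕ-+ n zero f = begin
  ∑[ i < n ℕ.+ 0 ] f (toℕ i)   ≡⟨ cong (λ k → ∑[ i < k ] f (toℕ i)) (ℕP.+-identityʳ n) ⟩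
  ∑[ i < n ] f (toℕ i)         ≡⟨ ℚP.+-identityʳ _ ⟨
  ∑[ i < n ] f (toℕ i) + 0ℚ    ∎
  where open ≡-Reasoning
sum-toℕ-+ n (suc d) f = begin
  ∑[ i < n ℕ.+ suc d ] f (toℕ i)                       ≡⟨ cong (λ k → ∑[ i < k ] f (toℕ i)) (ℕP.+-suc n d) ⟩
  ∑[ i < suc (n ℕ.+ d) ] f (toℕ i)                     ≡⟨ sum-toℕ-suc (n ℕ.+ d) f ⟩
  ∑[ i < n ℕ.+ d ] f (toℕ i) + f (n ℕ.+ d)             ≡⟨ cong (_+ f (n ℕ.+ d)) (sum-toℕ-+ n d f) ⟩
  ∑[ i < n ] f (toℕ i) + ∑[ i < d ] g (toℕ i) + g d    ≡⟨ ℚP.+-assoc (∑[ i < n ] f (toℕ i)) _ (g d) ⟩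
  ∑[ i < n ] f (toℕ i) + (∑[ i < d ] g (toℕ i) + g d)  ≡⟨ cong (∑[ i < n ] f (toℕ i) +_) (sum-toℕ-suc d g) ⟨
  ∑[ i < n ] f (toℕ i) + ∑[ i < suc d ] g (toℕ i)      ∎
  where
  open ≡-Reasoning
  g = λ i → f (n ℕ.+ i)

sum-const : ∀ n x → ∑[ i < n ] x ≡ ℕ→ℚ n * x
sum-const zero x = sym (ℚP.*-zeroˡ x)
sum-const (suc n) x = begin
  x + ∑[ i < n ] x        ≡⟨ cong (x +_) (sum-const n x) ⟩
  x + ℕ→ℚ n * x           ≡⟨ cong (_+ ℕ→ℚ n * x) (ℚP.*-identityˡ x) ⟨
  1ℚ * x + ℕ→ℚ n * x      ≡⟨ ℚP.*-distribʳ-+ x 1ℚ (ℕ→ℚ n) ⟨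
  (1ℚ + ℕ→ℚ n) * x        ≡⟨ cong (_* x) (ℕ→ℚ-suc n) ⟨
  ℕ→ℚ (suc n) * x         ∎
  where open ≡-Reasoning

sum-inv-∸≡H-H : ∀ {n k} → n ≤ℕ k → ∑[ i < n ] inv (ℕ→ℚ (k ∸ toℕ i)) ≡ H k - H (k ∸ n)
sum-inv-∸≡H-H {zero} {k} _ = sym (ℚP.+-inverseʳ (H k))
sum-inv-∸≡H-H {suc n} {k} n<k = begin
  ∑[ i < suc n ] inv (ℕ→ℚ (k ∸ toℕ i))          ≡⟨ sum-toℕ-suc n (λ i → inv (ℕ→ℚ (k ∸ i))) ⟩
  ∑[ i < n ] inv (ℕ→ℚ (k ∸ toℕ i)) + inv (ℕ→ℚ (k ∸ n))
                                                ≡⟨ cong (_+ inv (ℕ→ℚ (k ∸ n))) (sum-inv-∸≡H-H (ℕP.<⇒≤ n<k)) ⟩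
  H k - H (k ∸ n) + inv (ℕ→ℚ (k ∸ n))           ≡⟨ cong (λ l → H k - H l + inv (ℕ→ℚ l)) k∸n≡1+x ⟩
  H k - H (suc x) + inv (ℕ→ℚ (suc x))           ≡⟨ cong (λ h → H k - h + inv (ℕ→ℚ (suc x))) (H-suc x) ⟩
  H k - (H x + inv (ℕ→ℚ (suc x))) + inv (ℕ→ℚ (suc x))
                                                ≡⟨ solve 3 (λ a b u → a :- (b :+ u) :+ u := a :- b) refl (H k) (H x) _ ⟩
  H k - H x                                     ∎
  where
  open ≡-Reasoning
  open +-*-Solver
  x = k ∸ suc n
  k∸n≡1+x : k ∸ n ≡ suc x
  k∸n≡1+x = ℕP.+-∸-assoc 1 n<k

sum-mono-≤ : ∀ {n} {f g : Fin n → ℚ} → (∀ i → f i ≤ g i) → sum f ≤ sum g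
sum-mono-≤ {zero} f≤g = ℚP.≤-refl
sum-mono-≤ {suc n} f≤g = ℚP.+-mono-≤ (f≤g Fin.zero) (sum-mono-≤ (f≤g ∘ Fin.suc))

sum-mono-< : ∀ {n} {f g : Fin (suc n) → ℚ} → (∀ i → f i <ℚ g i) → sum f <ℚ sum g
sum-mono-< f<g = ℚP.+-mono-<-≤ (f<g Fin.zero) (sum-mono-≤ (ℚP.<⇒≤ ∘ f<g ∘ Fin.suc))

sum-≤⇒∃-≤ : ∀ {n} (f g : Fin (suc n) → ℚ) → sum f ≤ sum g → ∃[ i ] f i ≤ g i
sum-≤⇒∃-≤ f g ∑f≤∑g with FinP.any? (λ i → f i ℚP.≤? g i)
... | yes ∃fi≤gi = ∃fi≤gi
... | no ∄fi≤gi = ⊥-elim (ℚP.<-irrefl refl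
  (ℚP.≤-<-trans ∑f≤∑g (sum-mono-< (λ i → ℚP.≰⇒> (λ fi≤gi → ∄fi≤gi (i , fi≤gi))))))

sum-indicator : ∀ {n} (k : Fin n) x → ∑[ j < n ] (if does (k Fin.≟ j) then x else 0ℚ) ≡ x
sum-indicator {suc n} Fin.zero x = trans (cong (x +_) (sum-replicate-zero n)) (ℚP.+-identityʳ x)
sum-indicator {suc n} (Fin.suc k) x = trans (ℚP.+-identityˡ _) (sum-indicator k x)

sumℚ-map-+ : ∀ {A : Set} (f g : A → ℚ) xs →
             sumℚ (map (λ x → f x + g x) xs) ≡ sumℚ (map f xs) + sumℚ (map g xs)
sumℚ-map-+ f g [] = refl
sumℚ-map-+ f g (x ∷ xs) = trans (cong (f x + g x +_) (sumℚ-map-+ f g xs))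
                                (interchange (f x) (g x) _ _)

sumℚ-↭ : ∀ {xs ys} → xs ↭ ys → sumℚ xs ≡ sumℚ ys
sumℚ-↭ xs↭ys = ↭ₛP.foldr-commMonoid (setoid ℚ) ℚP.+-0-isCommutativeMonoid (↭⇒↭ₛ xs↭ys)

sumℚ-nonNeg : ∀ {xs} → All (0ℚ ≤_) xs → 0ℚ ≤ sumℚ xs
sumℚ-nonNeg [] = ℚP.≤-refl
sumℚ-nonNeg (0≤x ∷ 0≤xs) = ℚP.+-mono-≤ 0≤x (sumℚ-nonNeg 0≤xs)

sumℚ-∷ʳ : ∀ xs x → sumℚ (xs ∷ʳ x) ≡ sumℚ xs + x
sumℚ-∷ʳ [] x = trans (ℚP.+-identityʳ x) (sym (ℚP.+-identityˡ x))
sumℚ-∷ʳ (y ∷ xs) x = trans (cong (y +_) (sumℚ-∷ʳ xs x)) (sym (ℚP.+-assoc y _ x))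

sumℚ-applyUpTo-≤-suc : ∀ (f : ℕ → ℚ) n → 0ℚ ≤ f n → sumℚ (applyUpTo f n) ≤ sumℚ (applyUpTo f (suc n))
sumℚ-applyUpTo-≤-suc f n 0≤fn = begin
  sumℚ (applyUpTo f n)               ≡⟨ ℚP.+-identityʳ _ ⟨
  sumℚ (applyUpTo f n) + 0ℚ          ≤⟨ ℚP.+-monoʳ-≤ (sumℚ (applyUpTo f n)) 0≤fn ⟩
  sumℚ (applyUpTo f n) + f n         ≡⟨ sumℚ-∷ʳ (applyUpTo f n) (f n) ⟨
  sumℚ (applyUpTo f n ∷ʳ f n)        ≡⟨ cong sumℚ (applyUpTo-∷ʳ f n) ⟩
  sumℚ (applyUpTo f (suc n))         ∎
  where open ℚP.≤-Reasoning

sum-sumℚ-comm : ∀ {A : Set} {n} (h : Fin n → A → ℚ) xs →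
                ∑[ j < n ] sumℚ (map (h j) xs) ≡ sumℚ (map (λ x → ∑[ j < n ] h j x) xs)
sum-sumℚ-comm {n = n} h [] = sum-replicate-zero n
sum-sumℚ-comm h (x ∷ xs) = trans (∑-distrib-+ (λ j → h j x) (λ j → sumℚ (map (h j) xs)))
                                 (cong (sum (λ j → h j x) +_) (sum-sumℚ-comm h xs))

-- Past the end of the list `nth` returns 0ℚ, which f sends to 0ℚ.
sumℚ-applyUpTo-nth-≤ : ∀ (f : ℚ → ℚ) → (∀ x → 0ℚ ≤ f x) → f 0ℚ ≡ 0ℚ →
                       ∀ n xs → sumℚ (applyUpTo (f ∘ nth xs) n) ≤ sumℚ (map f xs)
sumℚ-applyUpTo-nth-≤ f 0≤f f0≡0 zero xs = sumℚ-nonNeg (All.map⁺ (universal 0≤f xs))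
sumℚ-applyUpTo-nth-≤ f 0≤f f0≡0 (suc n) [] =
  ℚP.+-mono-≤ (ℚP.≤-reflexive f0≡0) (sumℚ-applyUpTo-nth-≤ f 0≤f f0≡0 n [])
sumℚ-applyUpTo-nth-≤ f 0≤f f0≡0 (suc n) (x ∷ xs) =
  ℚP.+-monoʳ-≤ (f x) (sumℚ-applyUpTo-nth-≤ f 0≤f f0≡0 n xs)

below above : ℚ → ℚ → ℚ
below θ x = if does (x ℚP.≤? θ) then x else 0ℚ
above θ x = if does (θ ℚP.<? x) then x else 0ℚ

below+above : ∀ θ x → below θ x + above θ x ≡ x
below+above θ x = split (x ℚP.≤? θ) (θ ℚP.<? x)
  where
  split : (x≤?θ : Dec (x ≤ θ)) (θ<?x : Dec (θ <ℚ x)) →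
          (if does x≤?θ then x else 0ℚ) + (if does θ<?x then x else 0ℚ) ≡ x
  split (yes x≤θ) (yes θ<x) = ⊥-elim (ℚP.<-irrefl refl (ℚP.≤-<-trans x≤θ θ<x))
  split (yes _)   (no _)    = ℚP.+-identityʳ x
  split (no _)    (yes _)   = ℚP.+-identityˡ x
  split (no x≰θ)  (no θ≮x)  = ⊥-elim (θ≮x (ℚP.≰⇒> x≰θ))

below-nonNeg : ∀ θ {x} → 0ℚ ≤ x → 0ℚ ≤ below θ x
below-nonNeg θ {x} 0≤x = nonNeg (x ℚP.≤? θ)
  where
  nonNeg : (x≤?θ : Dec (x ≤ θ)) → 0ℚ ≤ (if does x≤?θ then x else 0ℚ)
  nonNeg (yes _) = 0≤x
  nonNeg (no _)  = ℚP.≤-refl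

above-nonNeg : ∀ {θ} → 0ℚ ≤ θ → ∀ x → 0ℚ ≤ above θ x
above-nonNeg {θ} 0≤θ x = nonNeg (θ ℚP.<? x)
  where
  nonNeg : (θ<?x : Dec (θ <ℚ x)) → 0ℚ ≤ (if does θ<?x then x else 0ℚ)
  nonNeg (yes θ<x) = ℚP.<⇒≤ (ℚP.≤-<-trans 0≤θ θ<x)
  nonNeg (no _)    = ℚP.≤-refl

above-0 : ∀ θ → above θ 0ℚ ≡ 0ℚ
above-0 θ = if-eta (does (θ ℚP.<? 0ℚ))

⌈p⌉≡-⌊-p⌋ : ∀ p → ℚ.⌈ p ⌉ ≡ ℤ.- ℚ.⌊ - p ⌋
⌈p⌉≡-⌊-p⌋ record{} = refl

module _ (m' : ℕ) {α : ℚ} (1<α : 1ℚ <ℚ α) where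
  private
    m = suc m'
    M = ℕ→ℚ m
    c = (α - 1ℚ) * M

    0<M : 0ℚ <ℚ M
    0<M = ℕ→ℚ-pos m'

    0≤M/α : 0ℚ ≤ M * inv α
    0≤M/α = *-nonNeg (ℚP.<⇒≤ 0<M) (ℚP.<⇒≤ (inv-pos (ℚP.<-trans (ℚP.positive⁻¹ 1ℚ) 1<α)))

    M/α<M : M * inv α <ℚ M
    M/α<M = subst (M * inv α <ℚ_) (ℚP.*-identityʳ M) (ℚP.*-monoʳ-<-pos M {{ℚ.positive 0<M}} (inv-<-1 1<α))

  ⌊m/α⌋ : ℕ
  ⌊m/α⌋ = ℤ.∣ ℚ.⌊ M * inv α ⌋ ∣

  ⌊M/α⌋≡⌊m/α⌋ : ℚ.⌊ M * inv α ⌋ ≡ ℤ.+ ⌊m/α⌋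
  ⌊M/α⌋≡⌊m/α⌋ = sym (ℤP.0≤i⇒+∣i∣≡i (fromℤ-<-suc⇒≤ (ℚP.≤-<-trans 0≤M/α (p<1+⌊p⌋ (M * inv α)))))

  ⌊m/α⌋≤m' : ⌊m/α⌋ ≤ℕ m'
  ⌊m/α⌋≤m' = ℕ.s≤s⁻¹ (ℤP.drop‿+<+ (subst (ℤ._< ℤ.+ m) ⌊M/α⌋≡⌊m/α⌋
    (fromℤ-cancel-< (ℚP.≤-<-trans (⌊p⌋≤p (M * inv α)) M/α<M))))

  kα≡1+m'∸⌊m/α⌋ : kα m α ≡ suc (m' ∸ ⌊m/α⌋)
  kα≡1+m'∸⌊m/α⌋ = begin
    ℤ.∣ ℚ.⌈ (1ℚ - inv α) * M ⌉ ∣                 ≡⟨ cong ℤ.∣_∣ (⌈p⌉≡-⌊-p⌋ ((1ℚ - inv α) * M)) ⟩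
    ℤ.∣ ℤ.- ℚ.⌊ - ((1ℚ - inv α) * M) ⌋ ∣         ≡⟨ ℤP.∣-i∣≡∣i∣ (ℚ.⌊ - ((1ℚ - inv α) * M) ⌋) ⟩
    ℤ.∣ ℚ.⌊ - ((1ℚ - inv α) * M) ⌋ ∣             ≡⟨ cong (λ p → ℤ.∣ ℚ.⌊ p ⌋ ∣) (negate (inv α) M) ⟩
    ℤ.∣ ℚ.⌊ M * inv α - fromℤ (ℤ.+ m) ⌋ ∣        ≡⟨ cong ℤ.∣_∣ (⌊p-i⌋≡⌊p⌋-i (M * inv α) (ℤ.+ m)) ⟩
    ℤ.∣ ℚ.⌊ M * inv α ⌋ ℤ.- ℤ.+ m ∣              ≡⟨ cong (λ i → ℤ.∣ i ℤ.- ℤ.+ m ∣) ⌊M/α⌋≡⌊m/α⌋ ⟩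
    ℤ.∣ ℤ.+ ⌊m/α⌋ ℤ.- ℤ.+ m ∣                    ≡⟨ cong ℤ.∣_∣ (ℤP.m-n≡m⊖n ⌊m/α⌋ m) ⟩
    ℤ.∣ ⌊m/α⌋ ℤ.⊖ m ∣                            ≡⟨ ℤP.∣⊖∣-≤ (ℕP.m≤n⇒m≤1+n ⌊m/α⌋≤m') ⟩
    m ∸ ⌊m/α⌋                                    ≡⟨ ℕP.+-∸-assoc 1 ⌊m/α⌋≤m' ⟩
    suc (m' ∸ ⌊m/α⌋)                             ∎
    where
    open ≡-Reasoning
    negate : ∀ i x → - ((1ℚ - i) * x) ≡ x * i - x
    negate = solve 2 (λ i x → :- ((con 1ℚ :- i) :* x) := x :* i :- x) refl
      where open +-*-Solver

  β-≤⌊m/α⌋ : ∀ {j} → j ≤ℕ ⌊m/α⌋ → β m α j ≡ c * inv (ℕ→ℚ (m ∸ j))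
  β-≤⌊m/α⌋ {j} j≤q = trans
    (cong (λ i → if does (ℤ.+ j ℤ.≤? i) then c * inv (ℕ→ℚ (m ∸ j)) else α) ⌊M/α⌋≡⌊m/α⌋)
    (cong (if_then c * inv (ℕ→ℚ (m ∸ j)) else α) (dec-true (ℤ.+ j ℤ.≤? ℤ.+ ⌊m/α⌋) (ℤ.+≤+ j≤q)))

  β->⌊m/α⌋ : ∀ {j} → ⌊m/α⌋ < j → β m α j ≡ α
  β->⌊m/α⌋ {j} q<j = trans
    (cong (λ i → if does (ℤ.+ j ℤ.≤? i) then c * inv (ℕ→ℚ (m ∸ j)) else α) ⌊M/α⌋≡⌊m/α⌋)
    (cong (if_then c * inv (ℕ→ℚ (m ∸ j)) else α)
          (dec-false (ℤ.+ j ℤ.≤? ℤ.+ ⌊m/α⌋) (ℕP.<⇒≱ q<j ∘ ℤP.drop‿+≤+)))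

  sum-β≡m : AlphaEq m α → ∑[ j < m ] β m α (suc (toℕ j)) ≡ M
  sum-β≡m αeq = begin
    ∑[ j < m ] G (toℕ j)                                  ≡⟨ cong (λ n → ∑[ j < n ] G (toℕ j)) q+k≡m ⟨
    ∑[ j < q ℕ.+ k ] G (toℕ j)                            ≡⟨ sum-toℕ-+ q k G ⟩
    ∑[ i < q ] G (toℕ i) + ∑[ i < k ] G (q ℕ.+ toℕ i)     ≡⟨ cong₂ _+_ (sum-cong-≗ {q} (β-≤⌊m/α⌋ ∘ FinP.toℕ<n))
                                                                        (sum-cong-≗ {k} (λ i → β->⌊m/α⌋ (s≤s (ℕP.m≤m+n q (toℕ i))))) ⟩
    ∑[ i < q ] (c * inv (ℕ→ℚ (m' ∸ toℕ i))) + ∑[ i < k ] α ≡⟨ cong₂ _+_ (*-distribˡ-sum {q} c (λ i → inv (ℕ→ℚ (m' ∸ toℕ i))))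
                                                                        (sym (sum-const k α)) ⟨
    c * ∑[ i < q ] inv (ℕ→ℚ (m' ∸ toℕ i)) + K * α         ≡⟨ cong (λ s → c * s + K * α) (sum-inv-∸≡H-H ⌊m/α⌋≤m') ⟩
    c * D + K * α                                         ≡⟨ cong (c * D +_) (ℚP.*-identityʳ (K * α)) ⟨
    c * D + K * α * 1ℚ                                    ≡⟨ cong (λ u → c * D + K * α * u) (inv-inverseʳ (≢-sym (ℚP.<⇒≢ 0<M))) ⟨
    c * D + K * α * (M * inv M)                           ≡⟨ factor α M D K (inv M) ⟩
    M * ((α - 1ℚ) * D + K * α * inv M)                    ≡⟨ cong (M *_) αeq′ ⟩
    M * 1ℚ                                                ≡⟨ ℚP.*-identityʳ M ⟩
    M                                                     ∎
    where
    open ≡-Reasoning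
    G = λ i → β m α (suc i)
    q = ⌊m/α⌋
    k = suc (m' ∸ q)
    K = ℕ→ℚ k
    D = H m' - H (m' ∸ q)
    αeq′ : (α - 1ℚ) * D + K * α * inv M ≡ 1ℚ
    αeq′ = subst (λ k → (α - 1ℚ) * (H m' - H (k ∸ 1)) + ℕ→ℚ k * α * inv M ≡ 1ℚ) kα≡1+m'∸⌊m/α⌋ αeq
    q+k≡m : q ℕ.+ k ≡ m
    q+k≡m = trans (ℕP.+-suc q (m' ∸ q)) (cong suc (ℕP.m+[n∸m]≡n ⌊m/α⌋≤m'))
    factor : ∀ a x d k i → (a - 1ℚ) * x * d + k * a * (x * i) ≡ x * ((a - 1ℚ) * d + k * a * i)
    factor = solve 5 (λ a x d k i → (a :- con 1ℚ) :* x :* d :+ k :* a :* (x :* i)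
                                    := x :* ((a :- con 1ℚ) :* d :+ k :* a :* i)) refl
      where open +-*-Solver

sum-smallLoad : ∀ {m} α p (a : ℕ → Fin m) t →
  ∑[ j < m ] smallLoad m α p a j t ≡ sumℚ (map (below ((α - 1ℚ) * L m p t) ∘ p) (range (t ∸ 1)))
sum-smallLoad {m} α p a t = begin
  ∑[ j < m ] smallLoad m α p a j t                        ≡⟨ sum-sumℚ-comm share (range (t ∸ 1)) ⟩
  sumℚ (map (λ i → ∑[ j < m ] share j i) (range (t ∸ 1))) ≡⟨ cong sumℚ (map-cong share-sum (range (t ∸ 1))) ⟩
  sumℚ (map (below θ ∘ p) (range (t ∸ 1)))                ∎
  where
  open ≡-Reasoning
  θ = (α - 1ℚ) * L m p t
  share : Fin m → ℕ → ℚ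
  share j i = if does (a i Fin.≟ j) ∧ isSmall m α p t i then p i else 0ℚ
  share-sum : ∀ i → ∑[ j < m ] share j i ≡ below θ (p i)
  share-sum i = trans (sum-cong-≗ {m} (λ j → if-∧ (does (a i Fin.≟ j)))) (sum-indicator (a i) (below θ (p i)))

sum-pHat≤ : ∀ m α p t → 0ℚ ≤ (α - 1ℚ) * L m p t →
  sumℚ (map (pHat m α p t) (range (2 ℕ.* m))) ≤ sumℚ (map (above ((α - 1ℚ) * L m p t) ∘ p) (range t))
sum-pHat≤ m α p t 0≤θ = begin
  sumℚ (map (pHat m α p t) (range (2 ℕ.* m)))   ≡⟨ cong sumℚ (map-applyUpTo suc (pHat m α p t) (2 ℕ.* m)) ⟩
  sumℚ (applyUpTo (above θ ∘ nth R) (2 ℕ.* m))  ≤⟨ sumℚ-applyUpTo-nth-≤ (above θ) (above-nonNeg 0≤θ) (above-0 θ) (2 ℕ.* m) R ⟩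
  sumℚ (map (above θ) R)                        ≡⟨ sumℚ-↭ (↭P.map⁺ (above θ) (↭-trans (↭-reverse _) (sort-↭ _))) ⟩
  sumℚ (map (above θ) (map p (range t)))        ≡⟨ cong sumℚ (map-∘ (range t)) ⟨
  sumℚ (map (above θ ∘ p) (range t))            ∎
  where
  open ℚP.≤-Reasoning
  θ = (α - 1ℚ) * L m p t
  R = reverse (sort (map p (range t)))

ℕ→ℚ*Lstar : ∀ m' α p t →
  ℕ→ℚ (suc m') * Lstar (suc m') α p t ≡ pPlus p t - sumℚ (map (pHat (suc m') α p t) (range (2 ℕ.* suc m')))
ℕ→ℚ*Lstar m' α p t = begin
  M * ((P - S) * inv M)    ≡⟨ solve 3 (λ x s i → x :* (s :* i) := s :* (x :* i)) refl M (P - S) (inv M) ⟩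
  (P - S) * (M * inv M)    ≡⟨ cong ((P - S) *_) (inv-inverseʳ (≢-sym (ℚP.<⇒≢ (ℕ→ℚ-pos m')))) ⟩
  (P - S) * 1ℚ             ≡⟨ ℚP.*-identityʳ (P - S) ⟩
  P - S                    ∎
  where
  open ≡-Reasoning
  open +-*-Solver
  M = ℕ→ℚ (suc m')
  P = pPlus p t
  S = sumℚ (map (pHat (suc m') α p t) (range (2 ℕ.* suc m')))

sum-smallLoad≤m*Lstar : ∀ m' {α} → 1ℚ ≤ α → ∀ p (a : ℕ → Fin (suc m')) t →
  (∀ i → 1 ≤ℕ i → i ≤ℕ suc t → 0ℚ ≤ p i) →
  ∑[ j < suc m' ] smallLoad (suc m') α p a j (suc t) ≤ ℕ→ℚ (suc m') * Lstar (suc m') α p (suc t)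
sum-smallLoad≤m*Lstar m' {α} 1≤α p a t 0≤p = begin
  ∑[ j < m ] smallLoad m α p a j (suc t)            ≡⟨ sum-smallLoad α p a (suc t) ⟩
  sumℚ (map (below θ ∘ p) (range t))                ≡⟨ cong sumℚ (map-applyUpTo suc (below θ ∘ p) t) ⟩
  sumℚ (applyUpTo (below θ ∘ p ∘ suc) t)            ≤⟨ sumℚ-applyUpTo-≤-suc (below θ ∘ p ∘ suc) t 0≤below-p[1+t] ⟩
  sumℚ (applyUpTo (below θ ∘ p ∘ suc) (suc t))      ≡⟨ cong sumℚ (map-applyUpTo suc (below θ ∘ p) (suc t)) ⟨
  Below                                             ≡⟨ solve 2 (λ b a → b := b :+ a :- a) refl Below Above ⟩
  Below + Above - Above                             ≡⟨ cong (_- Above) P≡Below+Above ⟨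
  P - Above                                         ≤⟨ ℚP.+-monoʳ-≤ P (ℚP.neg-antimono-≤ (sum-pHat≤ m α p (suc t) 0≤θ)) ⟩
  P - sumℚ (map (pHat m α p (suc t)) (range (2 ℕ.* m)))  ≡⟨ ℕ→ℚ*Lstar m' α p (suc t) ⟨
  ℕ→ℚ m * Lstar m α p (suc t)                       ∎
  where
  open ℚP.≤-Reasoning
  open +-*-Solver
  m = suc m'
  θ = (α - 1ℚ) * L m p (suc t)
  P = pPlus p (suc t)
  Below = sumℚ (map (below θ ∘ p) (range (suc t)))
  Above = sumℚ (map (above θ ∘ p) (range (suc t)))
  0≤below-p[1+t] : 0ℚ ≤ below θ (p (suc t))
  0≤below-p[1+t] = below-nonNeg θ (0≤p (suc t) (s≤s z≤n) ℕP.≤-refl)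
  P≡Below+Above : P ≡ Below + Above
  P≡Below+Above = trans (cong sumℚ (map-cong (λ i → sym (below+above θ (p i))) (range (suc t))))
                        (sumℚ-map-+ (below θ ∘ p) (above θ ∘ p) (range (suc t)))
  0≤P : 0ℚ ≤ P
  0≤P = sumℚ-nonNeg (All.map⁺ {f = p} (All.applyUpTo⁺₁ suc (suc t) (λ i<t → 0≤p _ (s≤s z≤n) i<t)))
  0≤L : 0ℚ ≤ L m p (suc t)
  0≤L = ℚP.≤-trans (*-nonNeg 0≤P (ℚP.<⇒≤ (inv-pos (ℕ→ℚ-pos m')))) (ℚP.p≤p⊔q (P * inv (ℕ→ℚ m)) _)
  0≤α-1 : 0ℚ ≤ α - 1ℚ
  0≤α-1 = subst (_≤ α - 1ℚ) (ℚP.+-inverseʳ 1ℚ) (ℚP.+-monoˡ-≤ (- 1ℚ) 1≤α)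
  0≤θ : 0ℚ ≤ θ
  0≤θ = *-nonNeg 0≤α-1 0≤L

lemma3 : (m : ℕ) → 2 ≤ℕ m → (α : ℚ) → 1ℚ <ℚ α → AlphaEq m α →
    (n : ℕ) (p : ℕ → ℚ) → (∀ i → 1 ≤ℕ i → i ≤ℕ n → 0ℚ <ℚ p i) →
    (a : ℕ → Fin m) → (t : ℕ) → 1 ≤ℕ t → t ≤ℕ n →
    (∀ s → 1 ≤ℕ s → s < t → ValidStep m α p a s) →
    ∃[ j ] smallLoad m α p a j t ≤ β m α (suc (toℕ j)) * Lstar m α p t
lemma3 (suc m') _ α 1<α αeq n p 0<p a (suc t) _ 1+t≤n _ =
  sum-≤⇒∃-≤ (λ j → smallLoad m α p a j (suc t)) (λ j → β m α (suc (toℕ j)) * L*) (begin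
    ∑[ j < m ] smallLoad m α p a j (suc t)  ≤⟨ sum-smallLoad≤m*Lstar m' (ℚP.<⇒≤ 1<α) p a t 0≤p ⟩
    ℕ→ℚ m * L*                              ≡⟨ cong (_* L*) (sum-β≡m m' 1<α αeq) ⟨
    ∑[ j < m ] β m α (suc (toℕ j)) * L*     ≡⟨ *-distribʳ-sum {m} L* (λ j → β m α (suc (toℕ j))) ⟩
    ∑[ j < m ] (β m α (suc (toℕ j)) * L*)   ∎)
  where
  open ℚP.≤-Reasoning
  m = suc m'
  L* = Lstar m α p (suc t)
  0≤p : ∀ i → 1 ≤ℕ i → i ≤ℕ suc t → 0ℚ ≤ p i
  0≤p i 1≤i i≤1+t = ℚP.<⇒≤ (0<p i 1≤i (ℕP.≤-trans i≤1+t 1+t≤n))
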